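{- Let $\mathcal{S}$ be a commutative semiring and $\Sigma$ a finite alphabet. For every expression $t\in\mathbf{MSOLEVAL}_{\mathcal{S}}$ there is a formula $\phi_t\in\mathbf{RMSOL}$ such that $WE(\phi_t,w,\sigma)=E(t,w,\sigma)$ for every word $w$ and every assignment $\sigma$ of the free variables; i.e., $\phi_t$ and $t$ define the same word function.
   Context: Word structures: a word $w=\sigma_1\cdots\sigma_n\in\Sigma^{\star}$ is represented by the structure $\mathcal{A}_w$ with universe $\{0,1,\dots,n\}$, the natural linear order $\le$, and unary predicates $P_a=\{i\in\{1,\dots,n\}:\sigma_i=a\}$ for $a\in\Sigma$. Variables range over positions of $w$ (first-order variables) and sets of positions (set variables); an assignment $\sigma$ maps free variables to these. $\mathbf{MSOLEVAL}_{\mathcal{S}}$ expressions: built inductively from monomials $\prod_{v:\phi(v)} r$ (with $r\in\mathcal{S}$ and $\phi$ an $\mathbf{MSOL}$ formula; value $r^{k}$ where $k$ is the number of elements $v$ satisfying $\phi$) closed under finite products of monomials and under sums $\sum_{\bar R:\phi(\bar R)} t$ over tuples $\bar R$ of subsets of the universe satisfying an $\mathbf{MSOL}$ formula $\phi$, where $t$ is an expression that may mention $\bar R$. Expressions may have free first-order and set variables occurring in their formulas; $E(t,w,\sigma)$ denotes the value in $\mathcal{S}$ of $t$ on $\mathcal{A}_w$ under assignment $\sigma$. Weighted MSOL ($\mathbf{WMSOL}$): formulas given by $\phi::= k\mid P_a(x)\mid\neg P_a(x)\mid x\le y\mid\neg x\le y\mid x\in X\mid x\notin X\mid\phi\vee\psi\mid\phi\wedge\psi\mid\exists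 x.\phi\mid\exists X.\phi\mid\forall x.\phi\mid\forall X.\phi$ with $k\in\mathcal{S}$, $a\in\Sigma$. Semantics $WE(\phi,w,\sigma)\in\mathcal{S}$: $WE(k)=k$; an atomic formula evaluates to $1$ if true and $0$ if false under $\sigma$; a negated atomic formula evaluates to $1$ if the atom is false and $0$ otherwise; $\vee$ is semiring sum, $\wedge$ semiring product; $\exists x$ (resp. $\exists X$) is the sum over all positions (resp. all sets of positions) of the value of the body; $\forall x$ (resp. $\forall X$) is the product over all positions (resp. all sets of positions) of the value of the body. $\mathbf{bMSOL}$: formulas $\phi::=0\mid1\mid P_a(x)\mid x\le y\mid x\in X\mid\neg\phi\mid\phi\wedge\psi\mid\forall x.\phi\mid\forall X.\phi$; their evaluation takes values in $\{0,1\}$ and coincides with the standard Boolean semantics of $\phi$ as an unweighted MSOL formula. A $\mathbf{bMSOL}$-step formula is a formula $\bigvee_{i\in I}(\phi_i\wedge k_i)$ with $I$ finite, $\phi_i\in\mathbf{bMSOL}$, $k_i\in\mathcal{S}$. $\mathbf{RMSOL}$ is the fragment of $\mathbf{WMSOL}$ in which universal second-order quantification $\forall X.\psi$ is allowed only for $\psi\in\mathbf{bMSOL}$ and universal first-order quantification $\forall x.\psi$ only for $\mathbf{bMSOL}$-step formulas $\psi$. -}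

module Defs where

open import Level using (Level)
open import Data.Bool using (Bool; true; false; if_then_else_; _∧_; _∨_; not)
open import Data.Nat using (ℕ; zero; suc; _≤ᵇ_)
import Data.Nat as ℕ
open import Data.Fin using (Fin; zero; suc; toℕ)
import Data.Fin as Fin
open import Data.Vec using (Vec; []; _∷_; lookup)
open import Data.List using (List; []; _∷_; foldr; map; concatMap; allFin)
open import Data.Bool.ListAction using (any; all)
open import Data.Product using (_×_; _,_)
open import Relation.Nullary using (does)
open import Algebra.Bundles using (CommutativeSemiring)

Pos : ℕ → Set
Pos n = Fin (suc n)

PosSet : ℕ → Set
PosSet n = Vec Bool (suc n)

allSubsets : (k : ℕ) → List (Vec Bool k)
allSubsets zero = [] ∷ []
allSubsets (suc k) = concatMap (λ s → (true ∷ s) ∷ (false ∷ s) ∷ []) (allSubsets k)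

-- Variables are named by natural numbers; first-order and set variables
-- live in separate name spaces.
record Assignment (n : ℕ) : Set where
  field
    fo : ℕ → Pos n
    so : ℕ → PosSet n
open Assignment public

updFO : ∀ {n} → Assignment n → ℕ → Pos n → Assignment n
updFO σ x i = record σ { fo = λ y → if does (y ℕ.≟ x) then i else fo σ y }

updSO : ∀ {n} → Assignment n → ℕ → PosSet n → Assignment n
updSO σ X A = record σ { so = λ Y → if does (Y ℕ.≟ X) then A else so σ Y }

module Words (m : ℕ) where
  Word : ℕ → Set
  Word n = Vec (Fin m) n

  -- P_a = { i ∈ {1..n} : σ_i = a }  (position 0 carries no letter)
  letterAt : ∀ {n} → Word n → Fin m → Pos n → Bool
  letterAt w a zero = false
  letterAt w a (suc j) = does (lookup w j Fin.≟ a)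

  leqPos : ∀ {n} → Pos n → Pos n → Bool
  leqPos i j = toℕ i ≤ᵇ toℕ j

  data MSOL : Set where
    ⊤′ ⊥′  : MSOL
    P      : Fin m → ℕ → MSOL
    leq    : ℕ → ℕ → MSOL
    mem    : ℕ → ℕ → MSOL
    neg    : MSOL → MSOL
    and or : MSOL → MSOL → MSOL
    exFO allFO : ℕ → MSOL → MSOL
    exSO allSO : ℕ → MSOL → MSOL

  sat : ∀ {n} → MSOL → Word n → Assignment n → Bool
  sat ⊤′ w σ = true
  sat ⊥′ w σ = false
  sat (P a x) w σ = letterAt w a (fo σ x)
  sat (leq x y) w σ = leqPos (fo σ x) (fo σ y)
  sat (mem x X) w σ = lookup (so σ X) (fo σ x)
  sat (neg φ) w σ = not (sat φ w σ)
  sat (and φ ψ) w σ = sat φ w σ ∧ sat ψ w σ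
  sat (or φ ψ) w σ = sat φ w σ ∨ sat ψ w σ
  sat {n} (exFO x φ) w σ = any (λ i → sat φ w (updFO σ x i)) (allFin (suc n))
  sat {n} (allFO x φ) w σ = all (λ i → sat φ w (updFO σ x i)) (allFin (suc n))
  sat {n} (exSO X φ) w σ = any (λ A → sat φ w (updSO σ X A)) (allSubsets (suc n))
  sat {n} (allSO X φ) w σ = all (λ A → sat φ w (updSO σ X A)) (allSubsets (suc n))

  data BMSOL : Set where
    b0 b1 : BMSOL
    bP    : Fin m → ℕ → BMSOL
    bLeq  : ℕ → ℕ → BMSOL
    bMem  : ℕ → ℕ → BMSOL
    bNeg  : BMSOL → BMSOL
    bAnd  : BMSOL → BMSOL → BMSOL
    bAllFO : ℕ → BMSOL → BMSOL
    bAllSO : ℕ → BMSOL → BMSOL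

  bsat : ∀ {n} → BMSOL → Word n → Assignment n → Bool
  bsat b0 w σ = false
  bsat b1 w σ = true
  bsat (bP a x) w σ = letterAt w a (fo σ x)
  bsat (bLeq x y) w σ = leqPos (fo σ x) (fo σ y)
  bsat (bMem x X) w σ = lookup (so σ X) (fo σ x)
  bsat (bNeg φ) w σ = not (bsat φ w σ)
  bsat (bAnd φ ψ) w σ = bsat φ w σ ∧ bsat ψ w σ
  bsat {n} (bAllFO x φ) w σ = all (λ i → bsat φ w (updFO σ x i)) (allFin (suc n))
  bsat {n} (bAllSO X φ) w σ = all (λ A → bsat φ w (updSO σ X A)) (allSubsets (suc n))

module Semantics {c ℓ : Level} (S : CommutativeSemiring c ℓ) (m : ℕ) where
  open CommutativeSemiring S
  open Words m public

  sumS : List Carrier → Carrier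
  sumS = foldr _+_ 0#

  prodS : List Carrier → Carrier
  prodS = foldr _*_ 1#

  powS : Carrier → ℕ → Carrier
  powS r zero = 1#
  powS r (suc k) = r * powS r k

  fromBool : Bool → Carrier
  fromBool b = if b then 1# else 0#

  record Monomial : Set c where
    constructor ∏[_∶_]_
    field
      var     : ℕ
      formula : MSOL
      base    : Carrier

  data Expr : Set c where
    prodMon : List Monomial → Expr
    -- Σ_{R̄ : φ(R̄)} t,  R̄ a tuple of set variables
    sumRel  : List ℕ → MSOL → Expr → Expr

  countPos : ∀ {n} → (Pos n → Bool) → ℕ
  countPos {n} p = foldr (λ i k → if p i then suc k else k) 0 (allFin (suc n))

  evalMon : ∀ {n} → Monomial → Word n → Assignment n → Carrier
  evalMon (∏[ v ∶ φ ] r) w σ = powS r (countPos (λ i → sat φ w (updFO σ v i)))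

  mutual
    E : ∀ {n} → Expr → Word n → Assignment n → Carrier
    E (prodMon ms) w σ = prodS (map (λ mo → evalMon mo w σ) ms)
    E (sumRel Rs φ t) w σ = sumTuples Rs φ t w σ

    sumTuples : ∀ {n} → List ℕ → MSOL → Expr → Word n → Assignment n → Carrier
    sumTuples [] φ t w σ = if sat φ w σ then E t w σ else 0#
    sumTuples {n} (R ∷ Rs) φ t w σ =
      sumS (map (λ A → sumTuples Rs φ t w (updSO σ R A)) (allSubsets (suc n)))

  -- RMSOL: the fragment of WMSOL where ∀X.ψ only for ψ ∈ bMSOL and
  -- ∀x.ψ only for bMSOL-step formulas ψ = ⋁_{i∈I} (φ_i ∧ k_i).

  Step : Set c
  Step = List (BMSOL × Carrier)

  data RMSOL : Set c where
    const        : Carrier → RMSOL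
    P⁺ P⁻        : Fin m → ℕ → RMSOL
    leq⁺ leq⁻    : ℕ → ℕ → RMSOL
    mem⁺ mem⁻    : ℕ → ℕ → RMSOL
    _∨ʷ_ _∧ʷ_    : RMSOL → RMSOL → RMSOL
    ∃x ∃X        : ℕ → RMSOL → RMSOL
    ∀X           : ℕ → BMSOL → RMSOL
    ∀x           : ℕ → Step → RMSOL

  WEstep : ∀ {n} → Step → Word n → Assignment n → Carrier
  WEstep ψ w σ = sumS (map (λ { (φ , k) → fromBool (bsat φ w σ) * k }) ψ)

  WE : ∀ {n} → RMSOL → Word n → Assignment n → Carrier
  WE (const k) w σ = k
  WE (P⁺ a x) w σ = fromBool (letterAt w a (fo σ x))
  WE (P⁻ a x) w σ = fromBool (not (letterAt w a (fo σ x)))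
  WE (leq⁺ x y) w σ = fromBool (leqPos (fo σ x) (fo σ y))
  WE (leq⁻ x y) w σ = fromBool (not (leqPos (fo σ x) (fo σ y)))
  WE (mem⁺ x X) w σ = fromBool (lookup (so σ X) (fo σ x))
  WE (mem⁻ x X) w σ = fromBool (not (lookup (so σ X) (fo σ x)))
  WE (φ ∨ʷ ψ) w σ = WE φ w σ + WE ψ w σ
  WE (φ ∧ʷ ψ) w σ = WE φ w σ * WE ψ w σ
  WE {n} (∃x x φ) w σ = sumS (map (λ i → WE φ w (updFO σ x i)) (allFin (suc n)))
  WE {n} (∃X X φ) w σ = sumS (map (λ A → WE φ w (updSO σ X A)) (allSubsets (suc n)))
  WE {n} (∀X X ψ) w σ = prodS (map (λ A → fromBool (bsat ψ w (updSO σ X A))) (allSubsets (suc n)))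
  WE {n} (∀x x ψ) w σ = prodS (map (λ i → WEstep ψ w (updFO σ x i)) (allFin (suc n)))

module Submission where

open import Defs
open import Level using (Level)
open import Data.Nat using (ℕ; zero; suc; _<_; _⊔_; _≟_)
open import Data.Nat.Properties using (<⇒≢; m⊔n<o⇒m<o; m⊔n<o⇒n<o; n<1+n)
open import Data.Product using (Σ; _,_; _×_)
open import Data.Bool using (Bool; true; false; not; _∧_; _∨_; if_then_else_)
open import Data.Bool.Properties using (not-involutive)
open import Data.Bool.ListAction using (and; or; any; all)
open import Data.List using (List; []; _∷_; map; foldr; allFin; tabulate)
import Data.Fin as Fin
open import Data.List.Properties using (map-cong)
open import Data.Vec using (lookup)
open import Function using (_∘_)
open import Algebra.Bundles using (CommutativeSemiring)
open import Relation.Binary.PropositionalEquality using (_≡_; _≗_; refl; cong; cong₂; trans)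
open import Relation.Nullary using (does)
open import Relation.Nullary.Decidable using (dec-false)

-- Every MSOL formula is equivalent to a bMSOL formula (de Morgan), so a
-- monomial ∏_{v:φ} r is the restricted universal ∀v.((φ ∧ r) ∨ (¬φ ∧ 1)).
-- The guard of a sum ∑_{R̄:φ} t becomes the 0/1 factor ∀x.(φ ∧ 1) for a first-order
-- variable x not occurring in φ: the product over the n + 1 positions of a
-- constant b ∈ {0,1} is b again.  Products of monomials are conjunctions,
-- and the sum over R̄ is a block of existential set quantifiers.

not-[not-∧] : ∀ a b → not (not a ∧ b) ≡ a ∨ not b
not-[not-∧] true  b = refl
not-[not-∧] false b = refl

not-[not-∧-not] : ∀ a b → not (not a ∧ not b) ≡ a ∨ b
not-[not-∧-not] a b = trans (not-[not-∧] a (not b)) (cong (a ∨_) (not-involutive b))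

all-cong : ∀ {A : Set} {f g : A → Bool} → f ≗ g → all f ≗ all g
all-cong f≗g xs = cong and (map-cong f≗g xs)

any-cong : ∀ {A : Set} {f g : A → Bool} → f ≗ g → any f ≗ any g
any-cong f≗g xs = cong or (map-cong f≗g xs)

not-all-not : ∀ {A : Set} (f : A → Bool) xs → not (all (not ∘ f) xs) ≡ any f xs
not-all-not f []       = refl
not-all-not f (x ∷ xs) =
  trans (not-[not-∧] (f x) (all (not ∘ f) xs)) (cong (f x ∨_) (not-all-not f xs))

module MSOLProperties (m : ℕ) where
  open Words m

  toBMSOL : MSOL → BMSOL
  toBMSOL ⊤′          = b1
  toBMSOL ⊥′          = b0
  toBMSOL (P a x)     = bP a x
  toBMSOL (leq x y)   = bLeq x y
  toBMSOL (mem x X)   = bMem x X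
  toBMSOL (neg φ)     = bNeg (toBMSOL φ)
  toBMSOL (and φ ψ)   = bAnd (toBMSOL φ) (toBMSOL ψ)
  toBMSOL (or φ ψ)    = bNeg (bAnd (bNeg (toBMSOL φ)) (bNeg (toBMSOL ψ)))
  toBMSOL (exFO x φ)  = bNeg (bAllFO x (bNeg (toBMSOL φ)))
  toBMSOL (allFO x φ) = bAllFO x (toBMSOL φ)
  toBMSOL (exSO X φ)  = bNeg (bAllSO X (bNeg (toBMSOL φ)))
  toBMSOL (allSO X φ) = bAllSO X (toBMSOL φ)

  bsat-toBMSOL : ∀ {n} φ (w : Word n) σ → bsat (toBMSOL φ) w σ ≡ sat φ w σ
  bsat-toBMSOL ⊤′          w σ = refl
  bsat-toBMSOL ⊥′          w σ = refl
  bsat-toBMSOL (P a x)     w σ = refl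
  bsat-toBMSOL (leq x y)   w σ = refl
  bsat-toBMSOL (mem x X)   w σ = refl
  bsat-toBMSOL (neg φ)     w σ = cong not (bsat-toBMSOL φ w σ)
  bsat-toBMSOL (and φ ψ)   w σ = cong₂ _∧_ (bsat-toBMSOL φ w σ) (bsat-toBMSOL ψ w σ)
  bsat-toBMSOL (or φ ψ)    w σ =
    trans (cong₂ (λ a b → not (not a ∧ not b)) (bsat-toBMSOL φ w σ) (bsat-toBMSOL ψ w σ))
          (not-[not-∧-not] (sat φ w σ) (sat ψ w σ))
  bsat-toBMSOL {n} (exFO x φ) w σ =
    trans (cong not (all-cong (cong not ∘ λ i → bsat-toBMSOL φ w (updFO σ x i)) (allFin (suc n))))
          (not-all-not (λ i → sat φ w (updFO σ x i)) (allFin (suc n)))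
  bsat-toBMSOL {n} (allFO x φ) w σ =
    all-cong (λ i → bsat-toBMSOL φ w (updFO σ x i)) (allFin (suc n))
  bsat-toBMSOL {n} (exSO X φ) w σ =
    trans (cong not (all-cong (cong not ∘ λ A → bsat-toBMSOL φ w (updSO σ X A)) (allSubsets (suc n))))
          (not-all-not (λ A → sat φ w (updSO σ X A)) (allSubsets (suc n)))
  bsat-toBMSOL {n} (allSO X φ) w σ =
    all-cong (λ A → bsat-toBMSOL φ w (updSO σ X A)) (allSubsets (suc n))

  -- Bounds the first-order variables occurring in atoms, bound ones included;
  -- set variables are not counted, since only first-order freshness is needed.
  foVarBound : MSOL → ℕ
  foVarBound ⊤′          = 0
  foVarBound ⊥′          = 0
  foVarBound (P a x)     = x
  foVarBound (leq x y)   = x ⊔ y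
  foVarBound (mem x X)   = x
  foVarBound (neg φ)     = foVarBound φ
  foVarBound (and φ ψ)   = foVarBound φ ⊔ foVarBound ψ
  foVarBound (or φ ψ)    = foVarBound φ ⊔ foVarBound ψ
  foVarBound (exFO x φ)  = foVarBound φ
  foVarBound (allFO x φ) = foVarBound φ
  foVarBound (exSO X φ)  = foVarBound φ
  foVarBound (allSO X φ) = foVarBound φ

  AgreeBelow : ∀ {n} → ℕ → Assignment n → Assignment n → Set
  AgreeBelow x σ τ = (∀ y → y < x → fo σ y ≡ fo τ y) × (∀ Y → so σ Y ≡ so τ Y)

  AgreeBelow-updFO : ∀ {n x} {σ τ : Assignment n} → AgreeBelow x σ τ →
                     ∀ y i → AgreeBelow x (updFO σ y i) (updFO τ y i)
  AgreeBelow-updFO {σ = σ} {τ} (foσ≡τ , soσ≡τ) y i = foUpd , soσ≡τ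
    where
    foUpd : ∀ z → z < _ → fo (updFO σ y i) z ≡ fo (updFO τ y i) z
    foUpd z z<x with does (z ≟ y)
    ... | true  = refl
    ... | false = foσ≡τ z z<x

  AgreeBelow-updSO : ∀ {n x} {σ τ : Assignment n} → AgreeBelow x σ τ →
                     ∀ Y A → AgreeBelow x (updSO σ Y A) (updSO τ Y A)
  AgreeBelow-updSO {σ = σ} {τ} (foσ≡τ , soσ≡τ) Y A = foσ≡τ , soUpd
    where
    soUpd : ∀ Z → so (updSO σ Y A) Z ≡ so (updSO τ Y A) Z
    soUpd Z with does (Z ≟ Y)
    ... | true  = refl
    ... | false = soσ≡τ Z

  sat-AgreeBelow : ∀ {n x} (w : Word n) φ → foVarBound φ < x →
                   ∀ {σ τ} → AgreeBelow x σ τ → sat φ w σ ≡ sat φ w τ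
  sat-AgreeBelow w ⊤′        _ _ = refl
  sat-AgreeBelow w ⊥′        _ _ = refl
  sat-AgreeBelow w (P a y)   y<x (fo≡ , _)   = cong (letterAt w a) (fo≡ y y<x)
  sat-AgreeBelow w (leq y z) y⊔z<x (fo≡ , _) =
    cong₂ leqPos (fo≡ y (m⊔n<o⇒m<o y z y⊔z<x)) (fo≡ z (m⊔n<o⇒n<o y z y⊔z<x))
  sat-AgreeBelow w (mem y Y) y<x (fo≡ , so≡) = cong₂ lookup (so≡ Y) (fo≡ y y<x)
  sat-AgreeBelow w (neg φ)   b<x agree = cong not (sat-AgreeBelow w φ b<x agree)
  sat-AgreeBelow w (and φ ψ) b<x agree =
    cong₂ _∧_ (sat-AgreeBelow w φ (m⊔n<o⇒m<o _ _ b<x) agree)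
              (sat-AgreeBelow w ψ (m⊔n<o⇒n<o _ _ b<x) agree)
  sat-AgreeBelow w (or φ ψ)  b<x agree =
    cong₂ _∨_ (sat-AgreeBelow w φ (m⊔n<o⇒m<o _ _ b<x) agree)
              (sat-AgreeBelow w ψ (m⊔n<o⇒n<o _ _ b<x) agree)
  sat-AgreeBelow {n} w (exFO y φ) b<x agree =
    any-cong (λ i → sat-AgreeBelow w φ b<x (AgreeBelow-updFO agree y i)) (allFin (suc n))
  sat-AgreeBelow {n} w (allFO y φ) b<x agree =
    all-cong (λ i → sat-AgreeBelow w φ b<x (AgreeBelow-updFO agree y i)) (allFin (suc n))
  sat-AgreeBelow {n} w (exSO Y φ) b<x agree =
    any-cong (λ A → sat-AgreeBelow w φ b<x (AgreeBelow-updSO agree Y A)) (allSubsets (suc n))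
  sat-AgreeBelow {n} w (allSO Y φ) b<x agree =
    all-cong (λ A → sat-AgreeBelow w φ b<x (AgreeBelow-updSO agree Y A)) (allSubsets (suc n))

  AgreeBelow-updFO-self : ∀ {n} x (σ : Assignment n) i → AgreeBelow x (updFO σ x i) σ
  AgreeBelow-updFO-self x σ i = foUpd , λ _ → refl
    where
    foUpd : ∀ y → y < x → fo (updFO σ x i) y ≡ fo σ y
    foUpd y y<x rewrite dec-false (y ≟ x) (<⇒≢ y<x) = refl

  sat-updFO-fresh : ∀ {n x} (w : Word n) φ → foVarBound φ < x →
                    ∀ σ i → sat φ w (updFO σ x i) ≡ sat φ w σ
  sat-updFO-fresh {x = x} w φ b<x σ i =
    sat-AgreeBelow w φ b<x (AgreeBelow-updFO-self x σ i)

module Translation {c ℓ : Level} (S : CommutativeSemiring c ℓ) (m : ℕ) where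
  open CommutativeSemiring S renaming (refl to ≈-refl; trans to ≈-trans)
  open Semantics S m
  open MSOLProperties m
  open import Relation.Binary.Reasoning.Setoid setoid

  count : ∀ {A : Set} → (A → Bool) → List A → ℕ
  count p = foldr (λ a k → if p a then suc k else k) 0

  sumS-cong : ∀ {A : Set} {f g : A → Carrier} → (∀ a → f a ≈ g a) →
              ∀ xs → sumS (map f xs) ≈ sumS (map g xs)
  sumS-cong f≈g []       = ≈-refl
  sumS-cong f≈g (x ∷ xs) = +-cong (f≈g x) (sumS-cong f≈g xs)

  prodS-map-if : ∀ {A : Set} (p : A → Bool) {r} {f : A → Carrier} →
                 (∀ a → f a ≈ (if p a then r else 1#)) →
                 ∀ xs → prodS (map f xs) ≈ powS r (count p xs)
  prodS-map-if p f≈ []       = ≈-refl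
  prodS-map-if p f≈ (x ∷ xs) with p x | f≈ x
  ... | true  | fx≈r = *-cong fx≈r (prodS-map-if p f≈ xs)
  ... | false | fx≈1 = ≈-trans (*-cong fx≈1 (prodS-map-if p f≈ xs)) (*-identityˡ _)

  powS-1# : ∀ k → powS 1# k ≈ 1#
  powS-1# zero    = ≈-refl
  powS-1# (suc k) = ≈-trans (*-identityˡ _) (powS-1# k)

  powS-fromBool : ∀ b k → powS (fromBool b) (suc k) ≈ fromBool b
  powS-fromBool true  k = ≈-trans (*-identityˡ _) (powS-1# k)
  powS-fromBool false k = zeroˡ _

  ifStep : BMSOL → Carrier → Step
  ifStep ψ r = (ψ , r) ∷ (bNeg ψ , 1#) ∷ []

  WEstep-ifStep : ∀ {n} ψ r (w : Word n) σ → WEstep (ifStep ψ r) w σ ≈ (if bsat ψ w σ then r else 1#)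
  WEstep-ifStep ψ r w σ = value (bsat ψ w σ)
    where
    value : ∀ b → fromBool b * r + (fromBool (not b) * 1# + 0#) ≈ (if b then r else 1#)
    value true  = ≈-trans (+-cong (*-identityˡ r) (≈-trans (+-identityʳ _) (zeroˡ 1#))) (+-identityʳ r)
    value false = ≈-trans (+-cong (zeroˡ r) (≈-trans (+-identityʳ _) (*-identityˡ 1#))) (+-identityˡ 1#)

  monomialToRMSOL : Monomial → RMSOL
  monomialToRMSOL (∏[ v ∶ φ ] r) = ∀x v (ifStep (toBMSOL φ) r)

  WE-monomialToRMSOL : ∀ {n} mo (w : Word n) σ → WE (monomialToRMSOL mo) w σ ≈ evalMon mo w σ
  WE-monomialToRMSOL {n} (∏[ v ∶ φ ] r) w σ =
    prodS-map-if (λ i → sat φ w (updFO σ v i)) WEstep≈ (allFin (suc n))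
    where
    WEstep≈ : ∀ i → WEstep (ifStep (toBMSOL φ) r) w (updFO σ v i) ≈ (if sat φ w (updFO σ v i) then r else 1#)
    WEstep≈ i = ≈-trans (WEstep-ifStep (toBMSOL φ) r w (updFO σ v i))
                        (reflexive (cong (if_then r else 1#) (bsat-toBMSOL φ w (updFO σ v i))))

  productToRMSOL : List Monomial → RMSOL
  productToRMSOL []        = const 1#
  productToRMSOL (mo ∷ ms) = monomialToRMSOL mo ∧ʷ productToRMSOL ms

  WE-productToRMSOL : ∀ {n} ms (w : Word n) σ → WE (productToRMSOL ms) w σ ≈ E (prodMon ms) w σ
  WE-productToRMSOL []        w σ = ≈-refl
  WE-productToRMSOL (mo ∷ ms) w σ = *-cong (WE-monomialToRMSOL mo w σ) (WE-productToRMSOL ms w σ)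

  guard : MSOL → RMSOL
  guard φ = ∀x (suc (foVarBound φ)) ((toBMSOL φ , 1#) ∷ [])

  WE-guard : ∀ {n} φ (w : Word n) σ → WE (guard φ) w σ ≈ fromBool (sat φ w σ)
  WE-guard {n} φ w σ = begin
    WE (guard φ) w σ
      ≈⟨ prodS-map-if (λ _ → true) WEstep≈ (allFin (suc n)) ⟩
    powS (fromBool (sat φ w σ)) (suc (count (λ _ → true) positives))
      ≈⟨ powS-fromBool (sat φ w σ) (count (λ _ → true) positives) ⟩
    fromBool (sat φ w σ) ∎
    where
    -- allFin (suc n) = zero ∷ positives: the universe {0,…,n} is never empty.
    positives : List (Fin.Fin (suc n))
    positives = tabulate {n = n} Fin.suc
    x : ℕ
    x = suc (foVarBound φ)
    WEstep≈ : ∀ i → WEstep ((toBMSOL φ , 1#) ∷ []) w (updFO σ x i) ≈ fromBool (sat φ w σ)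
    WEstep≈ i = ≈-trans (+-identityʳ _) (≈-trans (*-identityʳ _) (reflexive (cong fromBool
      (trans (bsat-toBMSOL φ w (updFO σ x i)) (sat-updFO-fresh w φ (n<1+n _) σ i)))))

  fromBool-* : ∀ b r → fromBool b * r ≈ (if b then r else 0#)
  fromBool-* true  r = *-identityˡ r
  fromBool-* false r = zeroˡ r

  mutual
    toRMSOL : Expr → RMSOL
    toRMSOL (prodMon ms)    = productToRMSOL ms
    toRMSOL (sumRel Rs φ t) = sumToRMSOL Rs φ t

    sumToRMSOL : List ℕ → MSOL → Expr → RMSOL
    sumToRMSOL []       φ t = guard φ ∧ʷ toRMSOL t
    sumToRMSOL (R ∷ Rs) φ t = ∃X R (sumToRMSOL Rs φ t)

  mutual
    WE-toRMSOL : ∀ {n} t (w : Word n) σ → WE (toRMSOL t) w σ ≈ E t w σ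
    WE-toRMSOL (prodMon ms)    w σ = WE-productToRMSOL ms w σ
    WE-toRMSOL (sumRel Rs φ t) w σ = WE-sumToRMSOL Rs φ t w σ

    WE-sumToRMSOL : ∀ {n} Rs φ t (w : Word n) σ → WE (sumToRMSOL Rs φ t) w σ ≈ sumTuples Rs φ t w σ
    WE-sumToRMSOL [] φ t w σ =
      ≈-trans (*-cong (WE-guard φ w σ) (WE-toRMSOL t w σ)) (fromBool-* (sat φ w σ) (E t w σ))
    WE-sumToRMSOL {n} (R ∷ Rs) φ t w σ =
      sumS-cong (λ A → WE-sumToRMSOL Rs φ t w (updSO σ R A)) (allSubsets (suc n))

theorem17 : {c ℓ : Level} (S : CommutativeSemiring c ℓ) (m : ℕ) →
    let open CommutativeSemiring S using (_≈_) in
    let open Semantics S m in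
    (t : Expr) → Σ RMSOL (λ φ →
    (n : ℕ) (w : Word n) (σ : Assignment n) → WE φ w σ ≈ E t w σ)
theorem17 S m t = toRMSOL t , λ n w σ → WE-toRMSOL t w σ
  where open Translation S m
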